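{- Let $\frac mn$ be an irreducible proper fraction ($0<m<n$) and let $x,y$ be positive integers with $ym-xn=1$. Then the decomposition \[ \frac mn=\frac xy+\frac1{ny} \] is faithful.
   Context: A decomposition of a positive rational $\frac mn$ is an expression $\frac mn=\sum_{i=1}^k\frac{a_i}{b_i}$ with $a_i$ positive integers and $b_i$ pairwise distinct positive integers. For a positive irreducible fraction $u=\frac mn$, it is faithful if for all integers $0\le x_i\le a_i$, $v=\sum_i\frac{x_i}{b_i}\notin\frac1n\mathbb Z$ unless $v=u$ or $v=0$. -}

module Defs where

open import Data.Nat as ℕ using (ℕ; zero; suc; _≤_; _<_)
open import Data.Integer as ℤ using (ℤ; +_)
open import Data.Rational as ℚ using (ℚ; ↧ₙ_; 0ℚ)
open import Data.Fin using (Fin; zero; suc)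
open import Data.Product using (∃-syntax; _×_)
open import Data.Sum using (_⊎_)
open import Function.Definitions using (Injective)
open import Relation.Binary.PropositionalEquality using (_≡_)

-- The rational x / b for natural numbers x, b.  (Junk value 0 when b = 0;
-- every use below is under the hypothesis b ≥ 1.)
frac : ℕ → ℕ → ℚ
frac x zero    = 0ℚ
frac x (suc d) = (+ x) ℚ./ suc d

sumℚ : (k : ℕ) → (Fin k → ℚ) → ℚ
sumℚ zero    f = 0ℚ
sumℚ (suc k) f = f zero ℚ.+ sumℚ k (λ i → f (suc i))

IsDecomposition : ℚ → (k : ℕ) → (a b : Fin k → ℕ) → Set
IsDecomposition u k a b =
  (∀ i → 1 ≤ a i) × (∀ i → 1 ≤ b i) × Injective _≡_ _≡_ b ×
  (sumℚ k (λ i → frac (a i) (b i)) ≡ u)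

InFracZ : ℕ → ℚ → Set
InFracZ n v = ∃[ z ] (∃[ w ] (n ≡ suc w × v ≡ z ℚ./ suc w))

Faithful : ℚ → (k : ℕ) → (a b : Fin k → ℕ) → Set
Faithful u k a b =
  (x : Fin k → ℕ) → (∀ i → x i ≤ a i) →
  InFracZ (↧ₙ u) (sumℚ k (λ i → frac (x i) (b i))) →
  sumℚ k (λ i → frac (x i) (b i)) ≡ u ⊎ sumℚ k (λ i → frac (x i) (b i)) ≡ 0ℚ

numsP : ℕ → Fin 2 → ℕ
numsP x zero    = x
numsP x (suc _) = 1

densP : ℕ → ℕ → Fin 2 → ℕ
densP n y zero    = y
densP n y (suc _) = n ℕ.* y

-- Over the common denominator n y the two terms read (a n + c)/(n y), and
-- 1 = y m − x n makes y coprime to n.  So if a/y + c/(n y) ∈ (1/n)ℤ with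
-- 0 ≤ a ≤ x, 0 ≤ c ≤ 1, then y ∣ a n + c; since x n + 1 = y m is also
-- divisible by y and a ≤ x < y, the residue a n + c (mod y) pins a down:
-- c = 0 forces a = 0 (value 0) and c = 1 forces a = x (value m/n).
module Submission where

open import Defs
open import Data.Nat using (ℕ; zero; suc; pred; NonZero; _+_; _*_; _∸_; _<_; _≤_; z≤n; s≤s)
open import Data.Nat.Properties as ℕ
  using (*-comm; *-monoʳ-≤; *-cancelʳ-<; m+[n∸m]≡n; m∸n≤m; m∸n≡0⇒m≤n; ≤-antisym; ≤-<-trans; <⇒≤; <⇒≢; m<m+n; m<m*n)
open import Data.Nat.Divisibility using (_∣_; divides; ∣m+n∣m⇒∣n; ∣-trans; ∣1⇒≡1; m∣m*n; n∣m*n; *-cancelʳ-∣; >⇒∤)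
open import Data.Nat.Coprimality using (Coprime; coprime-divisor)
open import Data.Nat.Solver using (module +-*-Solver)
open import Data.Integer as ℤ using (ℤ; +_; ∣_∣)
open import Data.Integer.Properties using (pos-*; abs-*)
open import Data.Rational as ℚ using (ℚ; 0ℚ; ↧ₙ_; toℚᵘ)
open import Data.Rational.Properties as ℚ
  using (toℚᵘ-injective; toℚᵘ-fromℚᵘ; toℚᵘ-homo-+; /-injective-≃; 0/n≡0; normalize-coprime)
open import Data.Rational.Unnormalised as ℚᵘ using (mkℚᵘ; *≡*)
open import Data.Rational.Unnormalised.Properties using (≃-sym; ≃-reflexive; +-cong; module ≃-Reasoning)
open import Data.Fin using (Fin; zero; suc)
open import Data.Product using (_×_; _,_)
open import Data.Sum using (_⊎_; inj₁; inj₂)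
open import Function.Definitions using (Injective)
open import Relation.Nullary using (contradiction)
open import Relation.Binary.PropositionalEquality
  using (_≡_; _≢_; refl; sym; trans; cong; cong₂; subst; module ≡-Reasoning)

open +-*-Solver

frac-cross : ∀ a b c d → a * suc d ≡ c * suc b → frac a (suc b) ≡ frac c (suc d)
frac-cross a b c d eq = toℚᵘ-injective (begin
  toℚᵘ (frac a (suc b))    ≈⟨ toℚᵘ-fromℚᵘ (mkℚᵘ (+ a) b) ⟩
  mkℚᵘ (+ a) b             ≈⟨ *≡* (trans (sym (pos-* a (suc d))) (trans (cong +_ eq) (pos-* c (suc b)))) ⟩
  mkℚᵘ (+ c) d             ≈⟨ ≃-sym (toℚᵘ-fromℚᵘ (mkℚᵘ (+ c) d)) ⟩
  toℚᵘ (frac c (suc d))    ∎)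
  where open ≃-Reasoning

frac-+-frac : ∀ a b c d →
  frac a (suc b) ℚ.+ frac c (suc d) ≡ frac (a * suc d + c * suc b) (suc b * suc d)
frac-+-frac a b c d = toℚᵘ-injective (begin
  toℚᵘ (frac a (suc b) ℚ.+ frac c (suc d))
    ≈⟨ toℚᵘ-homo-+ (frac a (suc b)) (frac c (suc d)) ⟩
  toℚᵘ (frac a (suc b)) ℚᵘ.+ toℚᵘ (frac c (suc d))
    ≈⟨ +-cong (toℚᵘ-fromℚᵘ (mkℚᵘ (+ a) b)) (toℚᵘ-fromℚᵘ (mkℚᵘ (+ c) d)) ⟩
  mkℚᵘ (+ a) b ℚᵘ.+ mkℚᵘ (+ c) d
    ≈⟨ ≃-reflexive (cong (λ t → mkℚᵘ t _) (sym (cong₂ ℤ._+_ (pos-* a (suc d)) (pos-* c (suc b))))) ⟩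
  mkℚᵘ (+ (a * suc d + c * suc b)) _
    ≈⟨ ≃-sym (toℚᵘ-fromℚᵘ _) ⟩
  toℚᵘ (frac (a * suc d + c * suc b) (suc b * suc d)) ∎)
  where open ≃-Reasoning

frac≡/⇒∣ : ∀ p b (z : ℤ) d → frac p (suc b) ≡ z ℚ./ suc d → suc b ∣ p * suc d
frac≡/⇒∣ p b z d eq with /-injective-≃ (mkℚᵘ (+ p) b) (mkℚᵘ z d) eq
... | *≡* cross = divides ∣ z ∣ (begin
  p * suc d                 ≡⟨ abs-* (+ p) (+ suc d) ⟨
  ∣ + p ℤ.* + suc d ∣       ≡⟨ cong ∣_∣ cross ⟩
  ∣ z ℤ.* + suc b ∣         ≡⟨ abs-* z (+ suc b) ⟩
  ∣ z ∣ * suc b             ∎)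
  where open ≡-Reasoning

sumℚ-2 : ∀ f → sumℚ 2 f ≡ f zero ℚ.+ f (suc zero)
sumℚ-2 f = cong (f zero ℚ.+_) (ℚ.+-identityʳ (f (suc zero)))

<∧∣⇒≡0 : ∀ {d k} → k < d → d ∣ k → k ≡ 0
<∧∣⇒≡0 {k = zero}  _   _   = refl
<∧∣⇒≡0 {k = suc _} k<d d∣k = contradiction d∣k (>⇒∤ k<d)

residue-injective : ∀ {d n r a b} → Coprime d n → a ≤ b → b < d →
  d ∣ a * n + r → d ∣ b * n + r → a ≡ b
residue-injective {d} {n} {r} {a} {b} d⊥n a≤b b<d d∣an+r d∣bn+r =
  ≤-antisym a≤b (m∸n≡0⇒m≤n b-a≡0)
  where
  open ≡-Reasoning
  split : (a * n + r) + (b ∸ a) * n ≡ b * n + r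
  split = begin
    (a * n + r) + (b ∸ a) * n ≡⟨ solve 4 (λ a r k n → (a :* n :+ r) :+ k :* n := (a :+ k) :* n :+ r) refl a r (b ∸ a) n ⟩
    (a + (b ∸ a)) * n + r     ≡⟨ cong (λ t → t * n + r) (m+[n∸m]≡n a≤b) ⟩
    b * n + r                 ∎
  d∣[b-a]n : d ∣ n * (b ∸ a)
  d∣[b-a]n = subst (d ∣_) (*-comm (b ∸ a) n) (∣m+n∣m⇒∣n (subst (d ∣_) (sym split) d∣bn+r) d∣an+r)
  b-a≡0 : b ∸ a ≡ 0
  b-a≡0 = <∧∣⇒≡0 (≤-<-trans (m∸n≤m b a) b<d) (coprime-divisor d⊥n d∣[b-a]n)

*≡*+1⇒coprime : ∀ {y m x n} → y * m ≡ x * n + 1 → Coprime y n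
*≡*+1⇒coprime {y} {m} {x} {n} ym≡xn+1 {d} (d∣y , d∣n) =
  ∣1⇒≡1 (∣m+n∣m⇒∣n (subst (d ∣_) ym≡xn+1 (∣-trans d∣y (m∣m*n m))) (∣-trans d∣n (n∣m*n x)))

*≡*+1⇒< : ∀ {y m x n} → m ≤ n → y * m ≡ x * n + 1 → x < y
*≡*+1⇒< {y} {m} {x} {n} m≤n ym≡xn+1 = *-cancelʳ-< n x y (begin-strict
  x * n     <⟨ m<m+n (x * n) (s≤s z≤n) ⟩
  x * n + 1 ≡⟨ ym≡xn+1 ⟨
  y * m     ≤⟨ *-monoʳ-≤ y m≤n ⟩
  y * n     ∎)
  where open ℕ.≤-Reasoning

densP-injective : ∀ n y .{{_ : NonZero y}} → 1 < n → Injective _≡_ _≡_ (densP n y)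
densP-injective n y 1<n = injective
  where
  y≢ny : y ≢ n * y
  y≢ny = <⇒≢ (subst (y <_) (*-comm y n) (m<m*n y n 1<n))
  injective : Injective _≡_ _≡_ (densP n y)
  injective {zero}     {zero}     _    = refl
  injective {zero}     {suc zero} y≡ny = contradiction y≡ny y≢ny
  injective {suc zero} {zero}     ny≡y = contradiction (sym ny≡y) y≢ny
  injective {suc zero} {suc zero} _    = refl

module Splitting (n′ y′ : ℕ) where
  N Y : ℕ
  N = suc n′
  Y = suc y′

  frac-+-frac-over-NY : ∀ a c → frac a Y ℚ.+ frac c (N * Y) ≡ frac (a * N + c) (N * Y)
  frac-+-frac-over-NY a c = trans (frac-+-frac a y′ c (pred (N * Y)))
    (frac-cross (a * (N * Y) + c * Y) (pred (Y * (N * Y))) (a * N + c) (pred (N * Y))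
      (solve 4 (λ a c n y → (a :* (n :* y) :+ c :* y) :* (n :* y) := (a :* n :+ c) :* (y :* (n :* y)))
             refl a c N Y))

  value : (Fin 2 → ℕ) → ℚ
  value xs = sumℚ 2 (λ i → frac (xs i) (densP N Y i))

  value≡ : ∀ xs → value xs ≡ frac (xs zero * N + xs (suc zero)) (N * Y)
  value≡ xs = trans (sumℚ-2 (λ i → frac (xs i) (densP N Y i)))
                    (frac-+-frac-over-NY (xs zero) (xs (suc zero)))

  value∈ℤ/N⇒Y∣ : ∀ xs → InFracZ N (value xs) → Y ∣ xs zero * N + xs (suc zero)
  value∈ℤ/N⇒Y∣ xs (z , w , refl , v≡z/N) = *-cancelʳ-∣ N (subst (_∣ p * N) (*-comm N Y) NY∣pN)
    where
    p : ℕ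
    p = xs zero * N + xs (suc zero)
    NY∣pN : N * Y ∣ p * N
    NY∣pN = frac≡/⇒∣ p (pred (N * Y)) z n′ (trans (sym (value≡ xs)) v≡z/N)

  module _ {m x : ℕ} (ym≡xn+1 : Y * m ≡ x * N + 1) where

    [xN+1]/NY≡m/N : frac (x * N + 1) (N * Y) ≡ frac m N
    [xN+1]/NY≡m/N = frac-cross (x * N + 1) (pred (N * Y)) m n′ (begin
      (x * N + 1) * N ≡⟨ cong (_* N) ym≡xn+1 ⟨
      Y * m * N       ≡⟨ solve 3 (λ y m n → y :* m :* n := m :* (n :* y)) refl Y m N ⟩
      m * (N * Y)     ∎)
      where open ≡-Reasoning

    value-nums≡ : value (numsP x) ≡ frac m N
    value-nums≡ = trans (value≡ (numsP x)) [xN+1]/NY≡m/N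

    module _ (m≤N : m ≤ N) where

      private
        Y⊥N : Coprime Y N
        Y⊥N = *≡*+1⇒coprime {x = x} ym≡xn+1
        x<Y : x < Y
        x<Y = *≡*+1⇒< m≤N ym≡xn+1

      residue-cases : ∀ a c → a ≤ x → c ≤ 1 → Y ∣ a * N + c →
        frac (a * N + c) (N * Y) ≡ frac m N ⊎ frac (a * N + c) (N * Y) ≡ 0ℚ
      residue-cases a 0 a≤x z≤n Y∣aN =
        inj₂ (trans (cong (λ t → frac (t * N + 0) (N * Y)) a≡0) (0/n≡0 (N * Y)))
        where
        a≡0 : a ≡ 0
        a≡0 = sym (residue-injective Y⊥N z≤n (≤-<-trans a≤x x<Y) (divides 0 refl) Y∣aN)
      residue-cases a 1 a≤x (s≤s z≤n) Y∣aN+1 =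
        inj₁ (trans (cong (λ t → frac (t * N + 1) (N * Y)) a≡x) [xN+1]/NY≡m/N)
        where
        a≡x : a ≡ x
        a≡x = residue-injective Y⊥N a≤x x<Y Y∣aN+1 (divides m (trans (sym ym≡xn+1) (*-comm Y m)))

      faithful : Coprime m N → Faithful (frac m N) 2 (numsP x) (densP N Y)
      faithful m⊥N xs xs≤nums v∈ℤ/↧ =
        subst (λ v → v ≡ frac m N ⊎ v ≡ 0ℚ) (sym (value≡ xs))
          (residue-cases (xs zero) (xs (suc zero)) (xs≤nums zero) (xs≤nums (suc zero))
            (value∈ℤ/N⇒Y∣ xs (subst (λ d → InFracZ d (value xs)) ↧ₙ[m/N]≡N v∈ℤ/↧)))
        where
        ↧ₙ[m/N]≡N : ↧ₙ frac m N ≡ N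
        ↧ₙ[m/N]≡N = cong ↧ₙ_ (normalize-coprime m⊥N)

    decomposition : 1 ≤ x → 1 < N → IsDecomposition (frac m N) 2 (numsP x) (densP N Y)
    decomposition 1≤x 1<N = nums-positive , dens-positive , densP-injective N Y 1<N , value-nums≡
      where
      nums-positive : ∀ i → 1 ≤ numsP x i
      nums-positive zero       = 1≤x
      nums-positive (suc zero) = s≤s z≤n
      dens-positive : ∀ i → 1 ≤ densP N Y i
      dens-positive zero       = s≤s z≤n
      dens-positive (suc zero) = s≤s z≤n

proposition2p4 : (m n x y : ℕ) → 0 < m → m < n → Coprime m n →
    1 ≤ x → 1 ≤ y → y * m ≡ x * n + 1 →
    let u = frac m n in
    IsDecomposition u 2 (numsP x) (densP n y) × Faithful u 2 (numsP x) (densP n y)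
proposition2p4 _       zero       _ _ _ ()        _ _ _ _
proposition2p4 zero    _          _ _ ()      _   _ _ _ _
proposition2p4 (suc _) (suc zero) _ _ _ (s≤s ()) _ _ _ _
proposition2p4 _       _          _ zero _ _ _ _ ()   _
proposition2p4 m (suc n′@(suc _)) x (suc y′) _ m<n m⊥n 1≤x _ ym≡xn+1 =
  decomposition ym≡xn+1 1≤x (s≤s (s≤s z≤n)) , faithful ym≡xn+1 (<⇒≤ m<n) m⊥n
  where open Splitting n′ y′
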